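{- Let $n\geq 3$ be an integer, let $k$ be an integer with $1\leq k\leq\frac{n}{2}$, and let $a,b$ be distinct odd positive integers less than $n$. Then $\mathrm{Ci}[2n,\{a,b\}]$ is isomorphic to $A[n,k]$ if and only if all three of the following hold: (i) $n$ is even and $k=2$; (ii) $\gcd(2n,a)=\gcd(2n,b)=1$; and (iii) $a+b=n$.
   Context: For distinct positive integers $a,b<n$, $\mathrm{Ci}[2n,\{a,b\}]$ denotes the quartic circulant graph with vertex set $\{x_1,\ldots,x_{2n}\}$ in which $x_i$ is adjacent to $x_{i+a},x_{i-a},x_{i+b},x_{i-b}$, indices taken modulo $2n$. For integers $n\geq 3$ and $1\leq k\leq \frac{n}{2}$, the accordion graph $A[n,k]$ is the 4-regular graph with vertex set $\{u_1,\ldots,u_n,v_1,\ldots,v_n\}$ such that $(u_1,\ldots,u_n)$ and $(v_1,\ldots,v_n)$ are $n$-cycles, $u_i$ is adjacent to $v_i$ and to $v_{i+k}$ for every $i\in\{1,\ldots,n\}$, indices taken modulo $n$ with residue system $\{1,\ldots,n\}$. -}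

module Defs where

open import Data.Nat using (ℕ; zero; suc; _+_; _*_; _%_)
open import Data.Nat.Divisibility using (_∣_)
open import Data.Fin using (Fin; toℕ)
open import Data.Sum using (_⊎_; inj₁; inj₂)
open import Relation.Binary.PropositionalEquality using (_≡_)
open import Relation.Nullary using (¬_)
open import Function.Bundles using (_⤖_; _⇔_; Bijection)

-- reduction modulo d (with the harmless convention m mod 0 = m; only used with d > 0)
_mod'_ : ℕ → ℕ → ℕ
m mod' zero = m
m mod' suc d = m % suc d

Odd : ℕ → Set
Odd m = ¬ (2 ∣ m)

Even : ℕ → Set
Even m = 2 ∣ m

record Graph : Set₁ where
  field
    V   : Set
    Adj : V → V → Set

open Graph public

record _≅_ (G H : Graph) : Set where
  field
    f   : V G ⤖ V H
    adj : ∀ x y → Adj G x y ⇔ Adj H (Bijection.to f x) (Bijection.to f y)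

CiAdj : (n a b : ℕ) → Fin (2 * n) → Fin (2 * n) → Set
CiAdj n a b i j =
  (toℕ j ≡ (toℕ i + a) mod' (2 * n)) ⊎ (toℕ i ≡ (toℕ j + a) mod' (2 * n)) ⊎
  (toℕ j ≡ (toℕ i + b) mod' (2 * n)) ⊎ (toℕ i ≡ (toℕ j + b) mod' (2 * n))

Ci : (n a b : ℕ) → Graph
Ci n a b = record { V = Fin (2 * n) ; Adj = CiAdj n a b }

-- accordion graph A[n,k]: inj₁ i = u_i, inj₂ i = v_i (0-indexed mod n)
AccAdj : (n k : ℕ) → Fin n ⊎ Fin n → Fin n ⊎ Fin n → Set
AccAdj n k (inj₁ i) (inj₁ j) = (toℕ j ≡ (toℕ i + 1) mod' n) ⊎ (toℕ i ≡ (toℕ j + 1) mod' n)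
AccAdj n k (inj₂ i) (inj₂ j) = (toℕ j ≡ (toℕ i + 1) mod' n) ⊎ (toℕ i ≡ (toℕ j + 1) mod' n)
AccAdj n k (inj₁ i) (inj₂ j) = (toℕ j ≡ toℕ i) ⊎ (toℕ j ≡ (toℕ i + k) mod' n)
AccAdj n k (inj₂ j) (inj₁ i) = (toℕ j ≡ toℕ i) ⊎ (toℕ j ≡ (toℕ i + k) mod' n)

Accordion : (n k : ℕ) → Graph
Accordion n k = record { V = Fin n ⊎ Fin n ; Adj = AccAdj n k }

module Submission where

-- For k = 1 the accordion has a triangle, but Ci[2n,{a,b}] with a, b odd has none, since every
-- edge changes the parity of the vertex. For k ≥ 3 the cycle u₀ u₁ … u₍ₙ₋₁₎ is rigid: u₍ᵢ₊₁₎ is the only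
-- common neighbour of uᵢ and u₍ᵢ₊₂₎. In Ci this forces consecutive steps of the cycle to be equal, so the
-- cycle is an arithmetic progression with an odd difference s and n s ≡ 0 (mod 2n), which is impossible.
-- Hence k = 2, where N(u₀) ⊆ N(v₁). In Ci a pair x ≠ y with N(x) ⊆ N(y) means that translation by
-- d = y - x ≢ 0 maps the jumps ±a, ±b to jumps; looking at ±a and at ±b separately gives d ≡ ±2a and
-- d ≡ ±2b (mod 2n), and then a + b = n. Since A[n,2] is connected, every common divisor of 2n, a and b
-- is 1; and gcd(2n, a) is odd, so it divides n and hence b = n - a, and symmetrically for b. Multiplication by a⁻¹ (mod 2n) is an isomorphism Ci[2n,{a,b}] ≅ Ci[2n,{1,n-1}], and this graph as
-- well as A[n,2] is the n-cycle with every vertex doubled: two vertices are adjacent iff their positions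
-- differ by ±1 modulo n.

module Lemmas where

  open import Data.Empty using (⊥; ⊥-elim)
  open import Data.Fin using (Fin; toℕ; fromℕ<; cast; splitAt; join)
  open import Data.Fin.Properties
    using (toℕ-fromℕ<; toℕ-injective; toℕ<n; toℕ-cast; toℕ-↑ˡ; toℕ-↑ʳ; splitAt-join; join-splitAt)
  open import Data.Integer as ℤ using (ℤ; +_; 0ℤ; _+_; _-_; -_; _*_)
  open import Data.Integer.DivMod using (_%ℕ_; _/ℕ_; n%ℕd<d; a≡a%ℕn+[a/ℕn]*n)
  open import Data.Nat.DivMod using (m%n<n)
  open import Data.Integer.Divisibility.Signed as ℤ∣ using (divides) renaming (_∣_ to _∣ℤ_)
  import Data.Integer.Properties as ℤ
  open import Data.Integer.Tactic.RingSolver using (solve-∀)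
  open import Data.Nat as ℕ using (ℕ; zero; suc; NonZero; _<_; _≤_; s≤s)
  open import Data.Nat.Divisibility as ℕ∣ using (_∣_)
  open import Data.Nat.Coprimality using (Coprime; coprime-divisor; gcd≡1⇒coprime; coprime-Bézout)
  open import Data.Nat.GCD using (gcd; gcd[m,n]∣m; gcd[m,n]∣n; module Bézout)
  import Data.Nat.Properties as ℕ
  open import Data.Product using (Σ; _×_; _,_; proj₁; proj₂)
  open import Data.Sum using (_⊎_; inj₁; inj₂)
  import Data.Sum
  open import Function.Base using (_∘_)
  open import Function.Bundles using (_⇔_; mk⇔; Equivalence; Bijection; mk↔ₛ′)
  open import Function.Properties.Inverse using (↔⇒⤖)
  open import Relation.Binary.Construct.Closure.ReflexiveTransitive using (Star; ε; _◅_; _◅◅_; gmap; reverse)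
  open import Data.Sum.Function.Propositional using (_⊎-⇔_)
  open import Relation.Binary.Bundles using (Setoid)
  open import Relation.Binary.Definitions using (tri<; tri≈; tri>)
  open import Relation.Binary.PropositionalEquality
  open import Relation.Nullary using (¬_)

  open import Defs

  infix 4 _≡_mod_

  -- Congruences of integers

  -- A record rather than a plain definition, so that x, y and M can be inferred from a proof of x ≡ y mod M.
  record _≡_mod_ (x y : ℤ) (M : ℕ) : Set where
    constructor mod-intro
    field divisibility : + M ∣ℤ x - y

  module _ {M : ℕ} where

    mod-reflexive : ∀ {x y} → x ≡ y → x ≡ y mod M
    mod-reflexive {x} refl = mod-intro (divides 0ℤ (trans (ℤ.+-inverseʳ x) (sym (ℤ.*-zeroˡ (+ M)))))

    mod-refl : ∀ {x} → x ≡ x mod M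
    mod-refl = mod-reflexive refl

    mod-sym : ∀ {x y} → x ≡ y mod M → y ≡ x mod M
    mod-sym {x} {y} (mod-intro p) = mod-intro (subst (+ M ∣ℤ_) (flip x y) (ℤ∣.∣m⇒∣-m p))
      where flip : ∀ x y → - (x - y) ≡ y - x
            flip = solve-∀

    mod-trans : ∀ {x y z} → x ≡ y mod M → y ≡ z mod M → x ≡ z mod M
    mod-trans {x} {y} {z} (mod-intro p) (mod-intro q) =
      mod-intro (subst (+ M ∣ℤ_) (telescope x y z) (ℤ∣.∣m∣n⇒∣m+n p q))
      where telescope : ∀ x y z → (x - y) + (y - z) ≡ x - z
            telescope = solve-∀

    +-cong-mod : ∀ {x y x′ y′} → x ≡ y mod M → x′ ≡ y′ mod M → x + x′ ≡ y + y′ mod M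
    +-cong-mod {x} {y} {x′} {y′} (mod-intro p) (mod-intro q) =
      mod-intro (subst (+ M ∣ℤ_) (regroup x y x′ y′) (ℤ∣.∣m∣n⇒∣m+n p q))
      where regroup : ∀ x y x′ y′ → (x - y) + (x′ - y′) ≡ (x + x′) - (y + y′)
            regroup = solve-∀

    neg-cong-mod : ∀ {x y} → x ≡ y mod M → - x ≡ - y mod M
    neg-cong-mod {x} {y} (mod-intro p) = mod-intro (subst (+ M ∣ℤ_) (negate x y) (ℤ∣.∣m⇒∣-m p))
      where negate : ∀ x y → - (x - y) ≡ - x - - y
            negate = solve-∀

    +-congˡ-mod : ∀ c {x y} → x ≡ y mod M → c + x ≡ c + y mod M
    +-congˡ-mod c = +-cong-mod (mod-refl {x = c})

    +-congʳ-mod : ∀ c {x y} → x ≡ y mod M → x + c ≡ y + c mod M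
    +-congʳ-mod c p = +-cong-mod p (mod-refl {x = c})

    *-congˡ-mod : ∀ c {x y} → x ≡ y mod M → c * x ≡ c * y mod M
    *-congˡ-mod c {x} {y} (mod-intro p) = mod-intro (subst (+ M ∣ℤ_) (distrib c x y) (ℤ∣.∣n⇒∣m*n c p))
      where distrib : ∀ c x y → c * (x - y) ≡ c * x - c * y
            distrib = solve-∀

    *-congʳ-mod : ∀ c {x y} → x ≡ y mod M → x * c ≡ y * c mod M
    *-congʳ-mod c {x} {y} p = subst₂ (_≡_mod M) (ℤ.*-comm c x) (ℤ.*-comm c y) (*-congˡ-mod c p)

    +-cancelˡ-mod : ∀ c {x y} → c + x ≡ c + y mod M → x ≡ y mod M
    +-cancelˡ-mod c {x} {y} (mod-intro p) = mod-intro (subst (+ M ∣ℤ_) (cancel c x y) p)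
      where cancel : ∀ c x y → (c + x) - (c + y) ≡ x - y
            cancel = solve-∀

    +-cancelʳ-mod : ∀ c {x y} → x + c ≡ y + c mod M → x ≡ y mod M
    +-cancelʳ-mod c {x} {y} p = +-cancelˡ-mod c (subst₂ (_≡_mod M) (ℤ.+-comm x c) (ℤ.+-comm y c) p)

    neg-swap-mod : ∀ {x y} → - x ≡ y mod M → x ≡ - y mod M
    neg-swap-mod {x} p = subst (_≡ _ mod M) (ℤ.neg-involutive x) (neg-cong-mod p)

    sub≡0⇒mod : ∀ {x y} → x - y ≡ 0ℤ mod M → x ≡ y mod M
    sub≡0⇒mod {x} {y} (mod-intro p) = mod-intro (subst (+ M ∣ℤ_) (ℤ.+-identityʳ (x - y)) p)


  *-cancelˡ-mod : ∀ {M} d .{{_ : NonZero d}} x y → + d * x ≡ + d * y mod (M ℕ.* d) → x ≡ y mod M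
  *-cancelˡ-mod {M} d x y (mod-intro (divides q dx-dy≡qMd)) =
    mod-intro (divides q (ℤ.*-cancelˡ-≡ (+ d) (x - y) (q * + M) (begin
      + d * (x - y)             ≡⟨ distrib (+ d) x y ⟩
      + d * x - + d * y         ≡⟨ dx-dy≡qMd ⟩
      q * + (M ℕ.* d)           ≡⟨ cong (q *_) (ℤ.pos-* M d) ⟩
      q * (+ M * + d)           ≡⟨ regroup q (+ M) (+ d) ⟩
      + d * (q * + M)           ∎)))
    where
    open ≡-Reasoning
    distrib : ∀ d x y → d * (x - y) ≡ d * x - d * y
    distrib = solve-∀
    regroup : ∀ q m d → q * (m * d) ≡ d * (q * m)
    regroup = solve-∀

  mod-setoid : ℕ → Setoid _ _
  mod-setoid M = record
    { Carrier = ℤ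
    ; _≈_ = _≡_mod M
    ; isEquivalence = record { refl = mod-refl ; sym = mod-sym ; trans = mod-trans }
    }

  mod-weaken : ∀ {d M x y} → d ∣ M → x ≡ y mod M → x ≡ y mod d
  mod-weaken {d} {M} d∣M (mod-intro p) = mod-intro (ℤ∣.∣-trans (ℤ∣.∣ᵤ⇒∣ {+ d} {+ M} d∣M) p)

  mod-0⇒∣ : ∀ {d m} → + m ≡ 0ℤ mod d → d ∣ m
  mod-0⇒∣ {d} {m} (mod-intro p) = subst (d ∣_) (ℕ.+-identityʳ m) (ℤ∣.∣⇒∣ᵤ p)

  ∣-below⇒≡0 : ∀ {M d} → d < M → M ∣ d → d ≡ 0
  ∣-below⇒≡0 {d = zero}  _   _   = refl
  ∣-below⇒≡0 {d = suc _} d<M M∣d = ⊥-elim (ℕ.<⇒≱ d<M (ℕ∣.∣⇒≤ M∣d))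

  ∣⇒≡0-mod : ∀ {d m} → d ∣ m → + m ≡ 0ℤ mod d
  ∣⇒≡0-mod {d} {m} d∣m = mod-intro (ℤ∣.∣ᵤ⇒∣ (subst (d ∣_) (sym (ℕ.+-identityʳ m)) d∣m))

  mod-unique-≤ : ∀ {M x y} → y ≤ x → x < M → + x ≡ + y mod M → x ≡ y
  mod-unique-≤ {M} {x} {y} y≤x x<M (mod-intro p) =
    ℕ.≤-antisym (ℕ.m∸n≡0⇒m≤n (∣-below⇒≡0 (ℕ.≤-<-trans (ℕ.m∸n≤m x y) x<M) M∣x∸y)) y≤x
    where
    ∣x-y∣≡x∸y : ℤ.∣ + x - + y ∣ ≡ x ℕ.∸ y
    ∣x-y∣≡x∸y = trans (cong ℤ.∣_∣ (ℤ.m-n≡m⊖n x y)) (trans (ℤ.∣m⊖n∣≡∣n⊖m∣ x y) (ℤ.∣⊖∣-≤ y≤x))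
    M∣x∸y : M ∣ x ℕ.∸ y
    M∣x∸y = subst (M ∣_) ∣x-y∣≡x∸y (ℤ∣.∣⇒∣ᵤ p)

  mod-unique : ∀ {M x y} → x < M → y < M → + x ≡ + y mod M → x ≡ y
  mod-unique {x = x} {y} x<M y<M x≡y with ℕ.≤-total x y
  ... | inj₁ x≤y = sym (mod-unique-≤ x≤y y<M (mod-sym x≡y))
  ... | inj₂ y≤x = mod-unique-≤ y≤x x<M x≡y

  self≡0-mod : ∀ {M} → + M ≡ 0ℤ mod M
  self≡0-mod {M} = mod-intro (divides (+ 1) (unit (+ M)))
    where unit : ∀ m → m - 0ℤ ≡ + 1 * m
          unit = solve-∀

  multiple-below-double⇒≡M : ∀ {M x} → 0 < x → x < M ℕ.+ M → + x ≡ 0ℤ mod M → x ≡ M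
  multiple-below-double⇒≡M {M} {x} 0<x x<2M x≡0 with ℕ.<-cmp x M
  ... | tri< x<M _ _ = ⊥-elim (ℕ.<⇒≢ 0<x (sym (mod-unique x<M (ℕ.≤-<-trans ℕ.z≤n x<M) x≡0)))
  ... | tri≈ _ x≡M _ = x≡M
  ... | tri> _ _ M<x = trans (sym M+r≡x) (trans (cong (M ℕ.+_) r≡0) (ℕ.+-identityʳ M))
    where
    r : ℕ
    r = x ℕ.∸ M
    M+r≡x : M ℕ.+ r ≡ x
    M+r≡x = ℕ.m+[n∸m]≡n (ℕ.<⇒≤ M<x)
    r<M : r < M
    r<M = ℕ.+-cancelˡ-< M r M (subst (_< M ℕ.+ M) (sym M+r≡x) x<2M)
    r≡0 : r ≡ 0
    r≡0 = mod-unique r<M (ℕ.≤-<-trans ℕ.z≤n r<M) (+-cancelˡ-mod (+ M) (begin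
      + M + + r      ≡⟨ cong +_ M+r≡x ⟩
      + x            ≈⟨ x≡0 ⟩
      0ℤ             ≈⟨ self≡0-mod ⟨
      + M            ≡⟨ ℤ.+-identityʳ (+ M) ⟨
      + M + 0ℤ       ∎))
      where open import Relation.Binary.Reasoning.Setoid (mod-setoid M)

  mod-lift : ∀ {M x y} → x ≡ y mod M → x ≡ y mod (2 ℕ.* M) ⊎ x ≡ y + + M mod (2 ℕ.* M)
  mod-lift {M} {x} {y} (mod-intro (divides q x-y≡qM)) with q %ℕ 2 | a≡a%ℕn+[a/ℕn]*n q 2 | n%ℕd<d q 2
  ... | 0 | q≡2r | _ = inj₁ (mod-intro (divides r (begin
    x - y                        ≡⟨ x-y≡qM ⟩
    q * + M                      ≡⟨ cong (_* + M) q≡2r ⟩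
    (+ 0 + r * + 2) * + M        ≡⟨ even r (+ M) ⟩
    r * (+ 2 * + M)              ≡⟨ cong (r *_) (ℤ.pos-* 2 M) ⟨
    r * + (2 ℕ.* M)              ∎)))
    where
    open ≡-Reasoning
    r : ℤ
    r = q /ℕ 2
    even : ∀ r m → (+ 0 + r * + 2) * m ≡ r * (+ 2 * m)
    even = solve-∀
  ... | 1 | q≡2r+1 | _ = inj₂ (mod-intro (divides r (begin
    x - (y + + M)                ≡⟨ regroup x y (+ M) ⟩
    (x - y) - + M                ≡⟨ cong (_- + M) x-y≡qM ⟩
    q * + M - + M                ≡⟨ cong (λ q → q * + M - + M) q≡2r+1 ⟩
    (+ 1 + r * + 2) * + M - + M  ≡⟨ odd r (+ M) ⟩
    r * (+ 2 * + M)              ≡⟨ cong (r *_) (ℤ.pos-* 2 M) ⟨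
    r * + (2 ℕ.* M)              ∎)))
    where
    open ≡-Reasoning
    r : ℤ
    r = q /ℕ 2
    regroup : ∀ x y m → x - (y + m) ≡ (x - y) - m
    regroup = solve-∀
    odd : ∀ r m → (+ 1 + r * + 2) * m - m ≡ r * (+ 2 * m)
    odd = solve-∀
  ... | suc (suc _) | _ | s≤s (s≤s ())

  mod′≡% : ∀ t M .{{_ : NonZero M}} → t mod' M ≡ t ℕ.% M
  mod′≡% t (suc _) = refl

  module _ (M : ℕ) .{{_ : NonZero M}} where

    %ℕ-correct : ∀ x → + (x %ℕ M) ≡ x mod M
    %ℕ-correct x = mod-intro (divides (- (x /ℕ M)) (begin
      + (x %ℕ M) - x                             ≡⟨ cong (λ y → + (x %ℕ M) - y) (a≡a%ℕn+[a/ℕn]*n x M) ⟩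
      + (x %ℕ M) - (+ (x %ℕ M) + (x /ℕ M) * + M) ≡⟨ cancel (+ (x %ℕ M)) (x /ℕ M) (+ M) ⟩
      - (x /ℕ M) * + M                           ∎))
      where
      open ≡-Reasoning
      cancel : ∀ r q m → r - (r + q * m) ≡ - q * m
      cancel = solve-∀

    residue : ℤ → Fin M
    residue x = fromℕ< (n%ℕd<d x M)

    residue-correct : ∀ x → + toℕ (residue x) ≡ x mod M
    residue-correct x rewrite toℕ-fromℕ< (n%ℕd<d x M) = %ℕ-correct x

    toℕ-injective-mod : ∀ {i j : Fin M} → + toℕ i ≡ + toℕ j mod M → i ≡ j
    toℕ-injective-mod {i} {j} p = toℕ-injective (mod-unique (toℕ<n i) (toℕ<n j) p)

    mod′⇔mod : ∀ (j : Fin M) t → (toℕ j ≡ t mod' M) ⇔ (+ toℕ j ≡ + t mod M)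
    mod′⇔mod j t = mk⇔ to from
      where
      to : toℕ j ≡ t mod' M → + toℕ j ≡ + t mod M
      to eq = subst (λ r → + r ≡ + t mod M) (sym (trans eq (mod′≡% t M))) (%ℕ-correct (+ t))
      from : + toℕ j ≡ + t mod M → toℕ j ≡ t mod' M
      from p = trans (mod-unique (toℕ<n j) (m%n<n t M) (mod-trans p (mod-sym (%ℕ-correct (+ t))))) (sym (mod′≡% t M))

    shift⇔ : ∀ (i j : Fin M) c → (toℕ j ≡ (toℕ i ℕ.+ c) mod' M) ⇔ (+ toℕ j ≡ + toℕ i + + c mod M)
    shift⇔ i j c = subst (λ t → (toℕ j ≡ (toℕ i ℕ.+ c) mod' M) ⇔ (+ toℕ j ≡ t mod M))
                         (ℤ.pos-+ (toℕ i) c) (mod′⇔mod j (toℕ i ℕ.+ c))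

    toℕ≡⇔mod : ∀ (i j : Fin M) → (toℕ j ≡ toℕ i) ⇔ (+ toℕ j ≡ + toℕ i mod M)
    toℕ≡⇔mod i j = mk⇔ (λ e → mod-reflexive (cong +_ e)) (mod-unique (toℕ<n j) (toℕ<n i))

  odd⇒≡1-mod-2 : ∀ {m} → Odd m → + m ≡ + 1 mod 2
  odd⇒≡1-mod-2 {m} odd with m ℕ.% 2 | %ℕ-correct 2 (+ m) | ℕ∣.m%n≡0⇒n∣m m 2 | m%n<n m 2
  ... | 0           | _ | 2∣m | _ = ⊥-elim (odd (2∣m refl))
  ... | 1           | r | _   | _ = mod-sym r
  ... | suc (suc _) | _ | _   | s≤s (s≤s ())

  1≢0-mod-2 : ¬ (+ 1 ≡ 0ℤ mod 2)
  1≢0-mod-2 p with mod-unique {2} {1} {0} (s≤s (s≤s ℕ.z≤n)) (s≤s ℕ.z≤n) p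
  ... | ()

  -1≡1-mod-2 : - + 1 ≡ + 1 mod 2
  -1≡1-mod-2 = mod-intro (divides (- + 1) refl)

  odd-divisor-coprime-2 : ∀ {d a} → d ∣ a → Odd a → Coprime d 2
  odd-divisor-coprime-2 _   _   {0} (_ , 0∣2) with ℕ∣.0∣⇒≡0 0∣2
  ... | ()
  odd-divisor-coprime-2 _   _   {1} _ = refl
  odd-divisor-coprime-2 d∣a odd {2} (2∣d , _) = ⊥-elim (odd (ℕ∣.∣-trans 2∣d d∣a))
  odd-divisor-coprime-2 _   _   {suc (suc (suc _))} (_ , i∣2) with ℕ∣.∣⇒≤ i∣2
  ... | s≤s (s≤s ())

  gcd-divides-complement : ∀ {n a b} → Odd a → a ℕ.+ b ≡ n → gcd (2 ℕ.* n) a ∣ b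
  gcd-divides-complement {n} {a} {b} odd a+b≡n = ℕ∣.∣m+n∣m⇒∣n (subst (gcd (2 ℕ.* n) a ∣_) (sym a+b≡n) g∣n) g∣a
    where
    g∣a : gcd (2 ℕ.* n) a ∣ a
    g∣a = gcd[m,n]∣n (2 ℕ.* n) a
    g∣n : gcd (2 ℕ.* n) a ∣ n
    g∣n = coprime-divisor (odd-divisor-coprime-2 g∣a odd) (gcd[m,n]∣m (2 ℕ.* n) a)

  odd+odd-even : ∀ {a b} → Odd a → Odd b → Even (a ℕ.+ b)
  odd+odd-even {a} {b} odd-a odd-b = mod-0⇒∣ (begin
    + (a ℕ.+ b)     ≡⟨ ℤ.pos-+ a b ⟩
    + a + + b       ≈⟨ +-cong-mod (odd⇒≡1-mod-2 odd-a) (odd⇒≡1-mod-2 odd-b) ⟩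
    + 2             ≈⟨ self≡0-mod ⟩
    0ℤ              ∎)
    where open import Relation.Binary.Reasoning.Setoid (mod-setoid 2)

  inverse-mod : ∀ {M a} → gcd M a ≡ 1 → Σ ℤ λ c → + a * c ≡ + 1 mod M
  inverse-mod {M} {a} g≡1 with coprime-Bézout (gcd≡1⇒coprime g≡1)
  ... | Bézout.+- x y 1+ya≡xM = - + y , mod-intro (divides (- + x) (begin
    + a * - + y - + 1           ≡⟨ negate (+ a) (+ y) ⟩
    - (+ 1 + + y * + a)         ≡⟨ cong (λ t → - (+ 1 + t)) (ℤ.pos-* y a) ⟨
    - + (1 ℕ.+ y ℕ.* a)         ≡⟨ cong (λ t → - + t) 1+ya≡xM ⟩
    - + (x ℕ.* M)               ≡⟨ cong -_ (ℤ.pos-* x M) ⟩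
    - (+ x * + M)               ≡⟨ ℤ.neg-distribˡ-* (+ x) (+ M) ⟩
    - + x * + M                 ∎))
    where
    open ≡-Reasoning
    negate : ∀ a y → a * - y - + 1 ≡ - (+ 1 + y * a)
    negate = solve-∀
  ... | Bézout.-+ x y 1+xM≡ya = + y , mod-intro (divides (+ x) (begin
    + a * + y - + 1             ≡⟨ cong (_- + 1) (ℤ.*-comm (+ a) (+ y)) ⟩
    + y * + a - + 1             ≡⟨ cong (λ t → t - + 1) (ℤ.pos-* y a) ⟨
    + (y ℕ.* a) - + 1           ≡⟨ cong (λ t → + t - + 1) 1+xM≡ya ⟨
    + (1 ℕ.+ x ℕ.* M) - + 1     ≡⟨ cong (λ t → t - + 1) (ℤ.pos-+ 1 (x ℕ.* M)) ⟩
    + 1 + + (x ℕ.* M) - + 1     ≡⟨ cancel (+ (x ℕ.* M)) ⟩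
    + (x ℕ.* M)                 ≡⟨ ℤ.pos-* x M ⟩
    + x * + M                   ∎))
    where
    open ≡-Reasoning
    cancel : ∀ t → + 1 + t - + 1 ≡ t
    cancel = solve-∀

  -- Graph isomorphisms and invariants

  module Iso {G H : Graph} (φ : G ≅ H) where

    open Bijection (_≅_.f φ) public using (to; injective)

    from : V H → V G
    from y = proj₁ (Bijection.strictlySurjective (_≅_.f φ) y)

    to∘from : ∀ y → to (from y) ≡ y
    to∘from y = proj₂ (Bijection.strictlySurjective (_≅_.f φ) y)

    from∘to : ∀ x → from (to x) ≡ x
    from∘to x = injective (to∘from (to x))

    adj-to : ∀ {x y} → Adj G x y → Adj H (to x) (to y)
    adj-to {x} {y} = Equivalence.to (_≅_.adj φ x y)

    adj-reflect : ∀ {x y} → Adj H (to x) (to y) → Adj G x y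
    adj-reflect {x} {y} = Equivalence.from (_≅_.adj φ x y)

    adj-from : ∀ {p q} → Adj H p q → Adj G (from p) (from q)
    adj-from {p} {q} h = adj-reflect (subst₂ (Adj H) (sym (to∘from p)) (sym (to∘from q)) h)

  mk≅ : ∀ {G H : Graph} (to : V G → V H) (from : V H → V G) →
        (∀ y → to (from y) ≡ y) → (∀ x → from (to x) ≡ x) →
        (∀ x y → Adj G x y ⇔ Adj H (to x) (to y)) → G ≅ H
  mk≅ to from to∘from from∘to adj = record { f = ↔⇒⤖ (mk↔ₛ′ to from to∘from from∘to) ; adj = adj }

  ≅-sym : ∀ {G H : Graph} → G ≅ H → H ≅ G
  ≅-sym {G} {H} φ = mk≅ from to from∘to to∘from adj
    where
    open Iso φ
    adj : ∀ p q → Adj H p q ⇔ Adj G (from p) (from q)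
    adj p q = mk⇔ adj-from (λ h → subst₂ (Adj H) (to∘from p) (to∘from q) (adj-to h))

  ≅-trans : ∀ {G H K : Graph} → G ≅ H → H ≅ K → G ≅ K
  ≅-trans φ ψ = mk≅ (Ψ.to ∘ Φ.to) (Φ.from ∘ Ψ.from)
    (λ z → trans (cong Ψ.to (Φ.to∘from _)) (Ψ.to∘from z))
    (λ x → trans (cong Φ.from (Ψ.from∘to _)) (Φ.from∘to x))
    (λ x y → mk⇔ (Ψ.adj-to ∘ Φ.adj-to) (Φ.adj-reflect ∘ Ψ.adj-reflect))
    where
    module Φ = Iso φ
    module Ψ = Iso ψ

  record Triangle (G : Graph) : Set where
    field
      x y z : V G
      xy : Adj G x y
      yz : Adj G y z
      xz : Adj G x z

  record DominatedPair (G : Graph) : Set where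
    field
      x y : V G
      distinct : x ≢ y
      dominated : ∀ {z} → Adj G x z → Adj G y z

  record RigidCycle (G : Graph) (L : ℕ) : Set where
    field
      walk : ℕ → V G
      step : ∀ i → Adj G (walk i) (walk (suc i))
      unique-middle : ∀ i {z} → Adj G (walk i) z → Adj G z (walk (2 ℕ.+ i)) → z ≡ walk (suc i)
      closed : walk L ≡ walk 0

  Connected : Graph → Set
  Connected G = ∀ x y → Star (Adj G) x y

  module _ {G H : Graph} (φ : G ≅ H) where
    open Iso φ

    private
      adj-reflectʳ : ∀ {x w} → Adj H (to x) w → Adj G x (from w)
      adj-reflectʳ {w = w} h = adj-reflect (subst (Adj H _) (sym (to∘from w)) h)

      adj-reflectˡ : ∀ {x w} → Adj H w (to x) → Adj G (from w) x
      adj-reflectˡ {w = w} h = adj-reflect (subst (λ v → Adj H v _) (sym (to∘from w)) h)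

      adj-toʳ : ∀ {x w} → Adj G x (from w) → Adj H (to x) w
      adj-toʳ {w = w} h = subst (Adj H _) (to∘from w) (adj-to h)

    ≅-preserves-Triangle : Triangle G → Triangle H
    ≅-preserves-Triangle t = record
      { x = to x ; y = to y ; z = to z ; xy = adj-to xy ; yz = adj-to yz ; xz = adj-to xz }
      where open Triangle t

    ≅-preserves-DominatedPair : DominatedPair G → DominatedPair H
    ≅-preserves-DominatedPair d = record
      { x = to x ; y = to y ; distinct = distinct ∘ injective ; dominated = adj-toʳ ∘ dominated ∘ adj-reflectʳ }
      where open DominatedPair d

    ≅-preserves-RigidCycle : ∀ {L} → RigidCycle G L → RigidCycle H L
    ≅-preserves-RigidCycle c = record
      { walk = to ∘ walk
      ; step = adj-to ∘ step
      ; unique-middle = λ i {z} h h′ →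
          trans (sym (to∘from z)) (cong to (unique-middle i (adj-reflectʳ h) (adj-reflectˡ h′)))
      ; closed = cong to closed
      }
      where open RigidCycle c

    ≅-preserves-Connected : Connected G → Connected H
    ≅-preserves-Connected conn p q =
      subst₂ (Star (Adj H)) (to∘from p) (to∘from q) (gmap to adj-to (conn (from p) (from q)))

  -- Circulant graphs

  Jump : ℕ → ℕ → ℤ → Set
  Jump a b x = x ≡ + a ⊎ x ≡ - + a ⊎ x ≡ + b ⊎ x ≡ - + b

  jump-swap : ∀ {a b x} → Jump a b x → Jump b a x
  jump-swap (inj₁ e)               = inj₂ (inj₂ (inj₁ e))
  jump-swap (inj₂ (inj₁ e))        = inj₂ (inj₂ (inj₂ e))
  jump-swap (inj₂ (inj₂ (inj₁ e))) = inj₁ e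
  jump-swap (inj₂ (inj₂ (inj₂ e))) = inj₂ (inj₁ e)

  jump-odd : ∀ {a b x} → Odd a → Odd b → Jump a b x → x ≡ + 1 mod 2
  jump-odd oa _ (inj₁ refl)               = odd⇒≡1-mod-2 oa
  jump-odd oa _ (inj₂ (inj₁ refl))        = mod-trans (neg-cong-mod (odd⇒≡1-mod-2 oa)) -1≡1-mod-2
  jump-odd _ ob (inj₂ (inj₂ (inj₁ refl))) = odd⇒≡1-mod-2 ob
  jump-odd _ ob (inj₂ (inj₂ (inj₂ refl))) = mod-trans (neg-cong-mod (odd⇒≡1-mod-2 ob)) -1≡1-mod-2

  module _ {M : ℕ} where

    shift-flip : ∀ {x y} c → x ≡ y + c mod M → y ≡ x - c mod M
    shift-flip {x} {y} c p = mod-trans (mod-reflexive (move y c)) (+-cong-mod (mod-sym p) mod-refl)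
      where move : ∀ y c → y ≡ (y + c) - c
            move = solve-∀

    shift-unflip : ∀ {x y} c → x ≡ y - c mod M → y ≡ x + c mod M
    shift-unflip {x} {y} c p = subst (λ c′ → y ≡ x + c′ mod M) (ℤ.neg-involutive c) (shift-flip (- c) p)

  Consecutive : ℕ → ℤ → ℤ → Set
  Consecutive M x y = y ≡ x + + 1 mod M ⊎ x ≡ y + + 1 mod M

  Consecutive-cong : ∀ {M x x′ y y′} → x ≡ x′ mod M → y ≡ y′ mod M → Consecutive M x y → Consecutive M x′ y′
  Consecutive-cong {x′ = x′} x≡x′ y≡y′ (inj₁ p) =
    inj₁ (mod-trans (mod-sym y≡y′) (mod-trans p (+-congʳ-mod (+ 1) x≡x′)))
  Consecutive-cong {y′ = y′} x≡x′ y≡y′ (inj₂ p) =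
    inj₂ (mod-trans (mod-sym x≡x′) (mod-trans p (+-congʳ-mod (+ 1) y≡y′)))

  module Circulant (n : ℕ) .{{_ : NonZero n}} where

    N : ℕ
    N = 2 ℕ.* n

    instance
      N≢0 : NonZero N
      N≢0 = ℕ.m*n≢0 2 n

    n∣N : n ∣ N
    n∣N = ℕ∣.divides 2 refl

    2∣N : 2 ∣ N
    2∣N = ℕ∣.divides n (ℕ.*-comm 2 n)

    odd-multiple : ∀ {x} → x ≡ + 1 mod 2 → ¬ (+ n * x ≡ 0ℤ mod N)
    odd-multiple {x} x≡1 nx≡0 = 1≢0-mod-2 (mod-trans (mod-sym x≡1) (*-cancelˡ-mod n x 0ℤ
      (subst (λ y → + n * x ≡ y mod N) (sym (ℤ.*-zeroʳ (+ n))) nx≡0)))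

    module _ {a b : ℕ} where

      ci-adj⇒jump : ∀ {i j} → CiAdj n a b i j → Σ ℤ λ x → Jump a b x × + toℕ j ≡ + toℕ i + x mod N
      ci-adj⇒jump {i} {j} (inj₁ e)               = + a , inj₁ refl , Equivalence.to (shift⇔ N i j a) e
      ci-adj⇒jump {i} {j} (inj₂ (inj₁ e))        =
        - + a , inj₂ (inj₁ refl) , shift-flip (+ a) (Equivalence.to (shift⇔ N j i a) e)
      ci-adj⇒jump {i} {j} (inj₂ (inj₂ (inj₁ e))) = + b , inj₂ (inj₂ (inj₁ refl)) , Equivalence.to (shift⇔ N i j b) e
      ci-adj⇒jump {i} {j} (inj₂ (inj₂ (inj₂ e))) =
        - + b , inj₂ (inj₂ (inj₂ refl)) , shift-flip (+ b) (Equivalence.to (shift⇔ N j i b) e)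

      jump⇒ci-adj : ∀ {i j x} → Jump a b x → + toℕ j ≡ + toℕ i + x mod N → CiAdj n a b i j
      jump⇒ci-adj {i} {j} (inj₁ refl)               p = inj₁ (Equivalence.from (shift⇔ N i j a) p)
      jump⇒ci-adj {i} {j} (inj₂ (inj₁ refl))        p =
        inj₂ (inj₁ (Equivalence.from (shift⇔ N j i a) (shift-unflip (+ a) p)))
      jump⇒ci-adj {i} {j} (inj₂ (inj₂ (inj₁ refl))) p = inj₂ (inj₂ (inj₁ (Equivalence.from (shift⇔ N i j b) p)))
      jump⇒ci-adj {i} {j} (inj₂ (inj₂ (inj₂ refl))) p =
        inj₂ (inj₂ (inj₂ (Equivalence.from (shift⇔ N j i b) (shift-unflip (+ b) p))))

      RigidCycle⇒jump-multiple : ∀ {L} → RigidCycle (Ci n a b) L →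
                                 Σ ℤ λ x → Jump a b x × + L * x ≡ 0ℤ mod N
      RigidCycle⇒jump-multiple {L} c = s 0 , js 0 , +-cancelˡ-mod (W 0) (begin
        W 0 + + L * s 0    ≈⟨ progression L ⟨
        W L                ≡⟨ cong (+_ ∘ toℕ) closed ⟩
        W 0                ≡⟨ ℤ.+-identityʳ (W 0) ⟨
        W 0 + 0ℤ           ∎)
        where
        open RigidCycle c
        open import Relation.Binary.Reasoning.Setoid (mod-setoid N)

        W : ℕ → ℤ
        W i = + toℕ (walk i)

        s : ℕ → ℤ
        s i = proj₁ (ci-adj⇒jump (step i))

        js : ∀ i → Jump a b (s i)
        js i = proj₁ (proj₂ (ci-adj⇒jump (step i)))

        hs : ∀ i → W (suc i) ≡ W i + s i mod N
        hs i = proj₂ (proj₂ (ci-adj⇒jump (step i)))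

        -- W i + s (suc i) is a common neighbour of W i and W (i + 2), hence it is W (suc i).
        s-suc : ∀ i → s (suc i) ≡ s i mod N
        s-suc i = +-cancelˡ-mod (W i) (begin
          W i + s (suc i)    ≈⟨ residue-correct N _ ⟨
          + toℕ z            ≡⟨ cong (+_ ∘ toℕ) z≡walk ⟩
          W (suc i)          ≈⟨ hs i ⟩
          W i + s i          ∎)
          where
          z : Fin N
          z = residue N (W i + s (suc i))
          z+s : W (2 ℕ.+ i) ≡ + toℕ z + s i mod N
          z+s = begin
            W (2 ℕ.+ i)              ≈⟨ hs (suc i) ⟩
            W (suc i) + s (suc i)    ≈⟨ +-congʳ-mod (s (suc i)) (hs i) ⟩
            W i + s i + s (suc i)    ≡⟨ swap₂ (W i) (s i) (s (suc i)) ⟩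
            W i + s (suc i) + s i    ≈⟨ +-congʳ-mod (s i) (residue-correct N (W i + s (suc i))) ⟨
            + toℕ z + s i            ∎
            where swap₂ : ∀ w x y → w + x + y ≡ w + y + x
                  swap₂ = solve-∀
          z≡walk : z ≡ walk (suc i)
          z≡walk = unique-middle i (jump⇒ci-adj (js (suc i)) (residue-correct N _)) (jump⇒ci-adj (js i) z+s)

        progression : ∀ i → W i ≡ W 0 + + i * s 0 mod N
        progression zero    = mod-reflexive (sym (trans (cong (λ y → W 0 + y) (ℤ.*-zeroˡ (s 0))) (ℤ.+-identityʳ (W 0))))
        progression (suc i) = begin
          W (suc i)                  ≈⟨ hs i ⟩
          W i + s i                  ≈⟨ +-cong-mod (progression i) (s≡s₀ i) ⟩
          W 0 + + i * s 0 + s 0      ≡⟨ step-AP (W 0) (+ i) (s 0) ⟩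
          W 0 + + suc i * s 0        ∎
          where
          s≡s₀ : ∀ i → s i ≡ s 0 mod N
          s≡s₀ zero    = mod-refl
          s≡s₀ (suc i) = mod-trans (s-suc i) (s≡s₀ i)
          step-AP : ∀ w i x → w + i * x + x ≡ w + (+ 1 + i) * x
          step-AP = solve-∀

    module _ {a b : ℕ} (odd-a : Odd a) (odd-b : Odd b) where

      ci-adj-parity : ∀ {i j} → CiAdj n a b i j → + toℕ j ≡ + toℕ i + + 1 mod 2
      ci-adj-parity {i} h with ci-adj⇒jump h
      ... | x , jx , j≡i+x = mod-trans (mod-weaken 2∣N j≡i+x) (+-congˡ-mod (+ toℕ i) (jump-odd odd-a odd-b jx))

      Ci-triangle-free : ¬ Triangle (Ci n a b)
      Ci-triangle-free t = 1≢0-mod-2 (+-cancelˡ-mod (X + + 1) (begin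
        X + + 1 + + 1       ≈⟨ +-congʳ-mod (+ 1) (ci-adj-parity xy) ⟨
        + toℕ y + + 1       ≈⟨ ci-adj-parity yz ⟨
        + toℕ z             ≈⟨ ci-adj-parity xz ⟩
        X + + 1             ≡⟨ ℤ.+-identityʳ (X + + 1) ⟨
        X + + 1 + 0ℤ        ∎))
        where
        open Triangle t
        open import Relation.Binary.Reasoning.Setoid (mod-setoid 2)
        X : ℤ
        X = + toℕ x

    double-injective : ∀ {u v} → u < n → v < n → + 2 * + u ≡ + 2 * + v mod N → u ≡ v
    double-injective {u} {v} u<n v<n p = ℕ.*-cancelˡ-≡ u v 2
      (mod-unique (ℕ.*-monoʳ-< 2 u<n) (ℕ.*-monoʳ-< 2 v<n)
        (subst₂ (_≡_mod N) (sym (ℤ.pos-* 2 u)) (sym (ℤ.pos-* 2 v)) p))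

    double≢0 : ∀ {u} → 0 < u → u < n → ¬ (+ 2 * + u ≡ 0ℤ mod N)
    double≢0 0<u u<n p = ℕ.<⇒≢ 0<u (sym (double-injective u<n (ℕ.≤-<-trans ℕ.z≤n u<n) p))

    doubles-opposite : ∀ {u v} → 0 < u → u < n → v < n → + 2 * + u ≡ - (+ 2 * + v) mod N → u ℕ.+ v ≡ n
    doubles-opposite {u} {v} 0<u u<n v<n p = ℕ.*-cancelˡ-≡ (u ℕ.+ v) n 2
      (multiple-below-double⇒≡M 0<2[u+v] 2[u+v]<2N (begin
        + (2 ℕ.* (u ℕ.+ v))           ≡⟨ expand u v ⟩
        + 2 * + u + + 2 * + v         ≈⟨ +-congʳ-mod (+ 2 * + v) p ⟩
        - (+ 2 * + v) + + 2 * + v     ≡⟨ ℤ.+-inverseˡ (+ 2 * + v) ⟩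
        0ℤ                            ∎))
      where
      open import Relation.Binary.Reasoning.Setoid (mod-setoid N)
      expand : ∀ u v → + (2 ℕ.* (u ℕ.+ v)) ≡ + 2 * + u + + 2 * + v
      expand u v = trans (ℤ.pos-* 2 (u ℕ.+ v)) (trans (cong (+ 2 *_) (ℤ.pos-+ u v)) (ℤ.*-distribˡ-+ (+ 2) (+ u) (+ v)))
      0<2[u+v] : 0 < 2 ℕ.* (u ℕ.+ v)
      0<2[u+v] = ℕ.*-monoʳ-< 2 (ℕ.<-≤-trans 0<u (ℕ.m≤m+n u v))
      2[u+v]<2N : 2 ℕ.* (u ℕ.+ v) < N ℕ.+ N
      2[u+v]<2N = subst (2 ℕ.* (u ℕ.+ v) <_) (ℕ.*-distribˡ-+ 2 n n) (ℕ.*-monoʳ-< 2 (ℕ.+-mono-< u<n v<n))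

    difference-mod : ∀ {p p′} {d t t′} → p ≡ d + t mod N → p′ ≡ d + t′ mod N → p - p′ ≡ t - t′ mod N
    difference-mod {p} {p′} {d} {t} {t′} h h′ = begin
      p - p′                  ≈⟨ +-cong-mod h (neg-cong-mod h′) ⟩
      (d + t) - (d + t′)      ≡⟨ cancel d t t′ ⟩
      t - t′                  ∎
      where
      open import Relation.Binary.Reasoning.Setoid (mod-setoid N)
      cancel : ∀ d t t′ → (d + t) - (d + t′) ≡ t - t′
      cancel = solve-∀

    module _ {u v : ℕ} (0<u : 0 < u) (u<n : u < n) (v<n : v < n) (u≢v : u ≢ v) where

      private
        twice : ∀ x → + 2 * x ≡ x - - x
        twice = solve-∀

        -twice : ∀ x → - (+ 2 * x) ≡ - x - x
        -twice = solve-∀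

        2u≡ : ∀ d t t′ → + u ≡ d + t mod N → - + u ≡ d + t′ mod N → + 2 * + u ≡ t - t′ mod N
        2u≡ d t t′ h h′ = mod-trans (mod-reflexive (twice (+ u))) (difference-mod {d = d} {t} {t′} h h′)

      ±u-shift⇒d≡±2u : ∀ {d} → ¬ (d ≡ 0ℤ mod N) →
                  Σ ℤ (λ t → Jump u v t × + u ≡ d + t mod N) →
                  Σ ℤ (λ t → Jump u v t × - + u ≡ d + t mod N) →
                  (d ≡ + 2 * + u mod N ⊎ d ≡ - (+ 2 * + u) mod N) ⊎ u ℕ.+ v ≡ n
      ±u-shift⇒d≡±2u d≢0 (_ , inj₁ refl , h) _ =
        ⊥-elim (d≢0 (mod-trans (shift-flip (+ u) h) (mod-reflexive (ℤ.+-inverseʳ (+ u)))))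
      ±u-shift⇒d≡±2u d≢0 _ (_ , inj₂ (inj₁ refl) , h′) =
        ⊥-elim (d≢0 (mod-trans (shift-flip (- + u) h′) (mod-reflexive (ℤ.+-inverseʳ (- + u)))))
      ±u-shift⇒d≡±2u _ (_ , inj₂ (inj₁ refl) , h) _ =
        inj₁ (inj₁ (mod-trans (shift-flip (- + u) h) (mod-reflexive (sym (twice (+ u))))))
      ±u-shift⇒d≡±2u _ _ (_ , inj₁ refl , h′) =
        inj₁ (inj₂ (mod-trans (shift-flip (+ u) h′) (mod-reflexive (sym (-twice (+ u))))))
      ±u-shift⇒d≡±2u {d} _ (_ , inj₂ (inj₂ (inj₁ refl)) , h) (_ , inj₂ (inj₂ (inj₁ refl)) , h′) =
        ⊥-elim (double≢0 0<u u<n (mod-trans (2u≡ d (+ v) (+ v) h h′) (mod-reflexive (ℤ.+-inverseʳ (+ v)))))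
      ±u-shift⇒d≡±2u {d} _ (_ , inj₂ (inj₂ (inj₁ refl)) , h) (_ , inj₂ (inj₂ (inj₂ refl)) , h′) =
        ⊥-elim (u≢v (double-injective u<n v<n
          (mod-trans (2u≡ d (+ v) (- + v) h h′) (mod-reflexive (sym (twice (+ v)))))))
      ±u-shift⇒d≡±2u {d} _ (_ , inj₂ (inj₂ (inj₂ refl)) , h) (_ , inj₂ (inj₂ (inj₁ refl)) , h′) =
        inj₂ (doubles-opposite 0<u u<n v<n (mod-trans (2u≡ d (- + v) (+ v) h h′) (mod-reflexive (sym (-twice (+ v))))))
      ±u-shift⇒d≡±2u {d} _ (_ , inj₂ (inj₂ (inj₂ refl)) , h) (_ , inj₂ (inj₂ (inj₂ refl)) , h′) =
        ⊥-elim (double≢0 0<u u<n (mod-trans (2u≡ d (- + v) (- + v) h h′) (mod-reflexive (ℤ.+-inverseʳ (- + v)))))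

    module _ {a b : ℕ} (0<a : 0 < a) (a<n : a < n) (0<b : 0 < b) (b<n : b < n) (a≢b : a ≢ b) where

      private
        both-doubles⇒sum : ∀ {d} → (d ≡ + 2 * + a mod N ⊎ d ≡ - (+ 2 * + a) mod N) ⊎ a ℕ.+ b ≡ n →
                          (d ≡ + 2 * + b mod N ⊎ d ≡ - (+ 2 * + b) mod N) ⊎ b ℕ.+ a ≡ n → a ℕ.+ b ≡ n
        both-doubles⇒sum (inj₂ a+b≡n) _ = a+b≡n
        both-doubles⇒sum _ (inj₂ b+a≡n) = trans (ℕ.+-comm a b) b+a≡n
        both-doubles⇒sum (inj₁ (inj₁ p)) (inj₁ (inj₁ q)) =
          ⊥-elim (a≢b (double-injective a<n b<n (mod-trans (mod-sym p) q)))
        both-doubles⇒sum (inj₁ (inj₁ p)) (inj₁ (inj₂ q)) = doubles-opposite 0<a a<n b<n (mod-trans (mod-sym p) q)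
        both-doubles⇒sum (inj₁ (inj₂ p)) (inj₁ (inj₁ q)) =
          doubles-opposite 0<a a<n b<n (neg-swap-mod (mod-trans (mod-sym p) q))
        both-doubles⇒sum (inj₁ (inj₂ p)) (inj₁ (inj₂ q)) =
          ⊥-elim (a≢b (double-injective a<n b<n
            (subst (_ ≡_mod N) (ℤ.neg-involutive _) (neg-swap-mod (mod-trans (mod-sym p) q)))))

      Ci-dominated⇒a+b≡n : DominatedPair (Ci n a b) → a ℕ.+ b ≡ n
      Ci-dominated⇒a+b≡n dp = both-doubles⇒sum
        (±u-shift⇒d≡±2u 0<a a<n b<n a≢b d≢0 (translate (inj₁ refl)) (translate (inj₂ (inj₁ refl))))
        (±u-shift⇒d≡±2u 0<b b<n a<n (a≢b ∘ sym) d≢0 (swapped (translate (inj₂ (inj₂ (inj₁ refl)))))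
                                                  (swapped (translate (inj₂ (inj₂ (inj₂ refl))))))
        where
        open DominatedPair dp
        open import Relation.Binary.Reasoning.Setoid (mod-setoid N)
        X Y d : ℤ
        X = + toℕ x
        Y = + toℕ y
        d = Y - X

        d≢0 : ¬ (d ≡ 0ℤ mod N)
        d≢0 p = distinct (sym (toℕ-injective-mod N (sub≡0⇒mod p)))

        -- X + s is adjacent to X, hence to Y
        translate : ∀ {s} → Jump a b s → Σ ℤ λ t → Jump a b t × s ≡ d + t mod N
        translate {s} js with ci-adj⇒jump (dominated (jump⇒ci-adj js (residue-correct N (X + s))))
        ... | t , jt , z≡Y+t = t , jt , +-cancelˡ-mod X (begin
          X + s             ≈⟨ residue-correct N (X + s) ⟨
          + toℕ (residue N (X + s)) ≈⟨ z≡Y+t ⟩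
          Y + t             ≡⟨ regroup X Y t ⟩
          X + (d + t)       ∎)
          where regroup : ∀ X Y t → Y + t ≡ X + ((Y - X) + t)
                regroup = solve-∀

        swapped : ∀ {s} → Σ ℤ (λ t → Jump a b t × s ≡ d + t mod N) → Σ ℤ (λ t → Jump b a t × s ≡ d + t mod N)
        swapped (t , jt , p) = t , jump-swap jt , p

    Ci-connected⇒gcd≡1 : ∀ {a b g} → Connected (Ci n a b) → g ∣ N → g ∣ a → g ∣ b → g ≡ 1
    Ci-connected⇒gcd≡1 {a} {b} {g} connected g∣N g∣a g∣b =
      ℕ∣.∣1⇒≡1 (mod-0⇒∣ (begin
        + 1                       ≈⟨ mod-weaken g∣N (residue-correct N (+ 1)) ⟨
        + toℕ (residue N (+ 1))   ≈⟨ reachable⇒≡ (connected (residue N (+ 1)) (residue N 0ℤ)) ⟩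
        + toℕ (residue N 0ℤ)      ≈⟨ mod-weaken g∣N (residue-correct N 0ℤ) ⟩
        0ℤ                        ∎))
      where
      open import Relation.Binary.Reasoning.Setoid (mod-setoid g)

      jump≡0 : ∀ {x} → Jump a b x → x ≡ 0ℤ mod g
      jump≡0 (inj₁ refl)               = ∣⇒≡0-mod g∣a
      jump≡0 (inj₂ (inj₁ refl))        = neg-cong-mod (∣⇒≡0-mod g∣a)
      jump≡0 (inj₂ (inj₂ (inj₁ refl))) = ∣⇒≡0-mod g∣b
      jump≡0 (inj₂ (inj₂ (inj₂ refl))) = neg-cong-mod (∣⇒≡0-mod g∣b)

      adjacent⇒≡ : ∀ {i j} → CiAdj n a b i j → + toℕ i ≡ + toℕ j mod g
      adjacent⇒≡ {i} {j} h with ci-adj⇒jump h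
      ... | x , jx , j≡i+x = mod-sym (begin
        + toℕ j         ≈⟨ mod-weaken g∣N j≡i+x ⟩
        + toℕ i + x     ≈⟨ +-congˡ-mod (+ toℕ i) (jump≡0 jx) ⟩
        + toℕ i + 0ℤ    ≡⟨ ℤ.+-identityʳ (+ toℕ i) ⟩
        + toℕ i         ∎)

      reachable⇒≡ : ∀ {i j} → Star (CiAdj n a b) i j → + toℕ i ≡ + toℕ j mod g
      reachable⇒≡ ε       = mod-refl
      reachable⇒≡ (e ◅ p) = mod-trans (adjacent⇒≡ e) (reachable⇒≡ p)

    scale-shift : ∀ k {I J x y} → J ≡ I + x mod N → k * x ≡ y mod N →
                  + toℕ (residue N (k * J)) ≡ + toℕ (residue N (k * I)) + y mod N
    scale-shift k {I} {J} {x} {y} J≡I+x kx≡y = begin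
      + toℕ (residue N (k * J))         ≈⟨ residue-correct N (k * J) ⟩
      k * J                             ≈⟨ *-congˡ-mod k J≡I+x ⟩
      k * (I + x)                       ≡⟨ ℤ.*-distribˡ-+ k I x ⟩
      k * I + k * x                     ≈⟨ +-cong-mod (residue-correct N (k * I)) (mod-sym kx≡y) ⟨
      + toℕ (residue N (k * I)) + y     ∎
      where open import Relation.Binary.Reasoning.Setoid (mod-setoid N)

    Ci-scaling : ∀ {a b a′ b′} c c′ → c′ * c ≡ + 1 mod N →
                 (∀ {x} → Jump a b x → Σ ℤ λ y → Jump a′ b′ y × c * x ≡ y mod N) →
                 (∀ {y} → Jump a′ b′ y → Σ ℤ λ x → Jump a b x × c′ * y ≡ x mod N) →
                 Ci n a b ≅ Ci n a′ b′
    Ci-scaling {a} {b} {a′} {b′} c c′ c′c≡1 forth back = mk≅ to from to∘from from∘to adj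
      where
      open import Relation.Binary.Reasoning.Setoid (mod-setoid N)
      to from : Fin N → Fin N
      to i = residue N (c * + toℕ i)
      from j = residue N (c′ * + toℕ j)

      inverse : ∀ k k′ → k * k′ ≡ + 1 mod N → ∀ i → residue N (k * + toℕ (residue N (k′ * + toℕ i))) ≡ i
      inverse k k′ kk′≡1 i = toℕ-injective-mod N (begin
        + toℕ (residue N (k * + toℕ (residue N (k′ * I))))   ≈⟨ residue-correct N _ ⟩
        k * + toℕ (residue N (k′ * I))                       ≈⟨ *-congˡ-mod k (residue-correct N (k′ * I)) ⟩
        k * (k′ * I)                                         ≡⟨ ℤ.*-assoc k k′ I ⟨
        k * k′ * I                                           ≈⟨ *-congʳ-mod I kk′≡1 ⟩
        + 1 * I                                              ≡⟨ ℤ.*-identityˡ I ⟩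
        I                                                    ∎)
        where
        I : ℤ
        I = + toℕ i

      to∘from : ∀ j → to (from j) ≡ j
      to∘from = inverse c c′ (subst (_≡ + 1 mod N) (ℤ.*-comm c′ c) c′c≡1)

      from∘to : ∀ i → from (to i) ≡ i
      from∘to = inverse c′ c c′c≡1

      adj : ∀ i j → CiAdj n a b i j ⇔ CiAdj n a′ b′ (to i) (to j)
      adj i j = mk⇔ forward backward
        where
        forward : CiAdj n a b i j → CiAdj n a′ b′ (to i) (to j)
        forward h with ci-adj⇒jump h
        ... | x , jx , j≡i+x with forth jx
        ...   | y , jy , cx≡y = jump⇒ci-adj jy (scale-shift c j≡i+x cx≡y)
        backward : CiAdj n a′ b′ (to i) (to j) → CiAdj n a b i j
        backward h with ci-adj⇒jump h
        ... | y , jy , tj≡ti+y with back jy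
        ...   | x , jx , c′y≡x =
          subst₂ (CiAdj n a b) (from∘to i) (from∘to j) (jump⇒ci-adj jx (scale-shift c′ tj≡ti+y c′y≡x))

    private
      pred-n : + n ≡ + ℕ.pred n + + 1
      pred-n = cong +_ (trans (sym (ℕ.suc-pred n)) (ℕ.+-comm 1 (ℕ.pred n)))

    -- The jumps ±1, ±(n - 1) are ±1 modulo n, and a step of ±1 modulo n lifts to one of them modulo 2n.
    Ci-unit⇔Consecutive : ∀ i j → CiAdj n 1 (ℕ.pred n) i j ⇔ Consecutive n (+ toℕ i) (+ toℕ j)
    Ci-unit⇔Consecutive i j = mk⇔ to from
      where
      m i′ j′ : ℤ
      m = + ℕ.pred n
      i′ = + toℕ i
      j′ = + toℕ j

      m≡-1 : m ≡ - + 1 mod n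
      m≡-1 = mod-intro (divides (+ 1) (begin
        m - - + 1     ≡⟨ cong (λ x → m + x) (ℤ.neg-involutive (+ 1)) ⟩
        m + + 1       ≡⟨ pred-n ⟨
        + n           ≡⟨ ℤ.*-identityˡ (+ n) ⟨
        + 1 * + n     ∎))
        where open ≡-Reasoning

      1+n≡-m : + 1 + + n ≡ - m mod N
      1+n≡-m = mod-intro (divides (+ 1) (begin
        + 1 + + n - - m          ≡⟨ cong (λ x → + 1 + x - - m) pred-n ⟩
        + 1 + (m + + 1) - - m    ≡⟨ double m ⟩
        + 1 * (+ 2 * (m + + 1))  ≡⟨ cong (λ x → + 1 * (+ 2 * x)) pred-n ⟨
        + 1 * (+ 2 * + n)        ≡⟨ cong (+ 1 *_) (ℤ.pos-* 2 n) ⟨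
        + 1 * + N                ∎))
        where
        open ≡-Reasoning
        double : ∀ m → + 1 + (m + + 1) - - m ≡ + 1 * (+ 2 * (m + + 1))
        double = solve-∀

      to : CiAdj n 1 (ℕ.pred n) i j → Consecutive n i′ j′
      to h with ci-adj⇒jump h
      ... | _ , inj₁ refl , p               = inj₁ (mod-weaken n∣N p)
      ... | _ , inj₂ (inj₁ refl) , p        = inj₂ (shift-unflip (+ 1) (mod-weaken n∣N p))
      ... | _ , inj₂ (inj₂ (inj₁ refl)) , p =
        inj₂ (shift-unflip (+ 1) (mod-trans (mod-weaken n∣N p) (+-congˡ-mod i′ m≡-1)))
      ... | _ , inj₂ (inj₂ (inj₂ refl)) , p =
        inj₁ (mod-trans (mod-weaken n∣N p) (+-congˡ-mod i′ (mod-sym (neg-swap-mod (mod-sym m≡-1)))))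

      from : Consecutive n i′ j′ → CiAdj n 1 (ℕ.pred n) i j
      from (inj₁ j′≡i′+1) with mod-lift j′≡i′+1
      ... | inj₁ p = jump⇒ci-adj (inj₁ refl) p
      ... | inj₂ p = jump⇒ci-adj (inj₂ (inj₂ (inj₂ refl)))
                       (mod-trans p (mod-trans (mod-reflexive (ℤ.+-assoc i′ (+ 1) (+ n))) (+-congˡ-mod i′ 1+n≡-m)))
      from (inj₂ i′≡j′+1) with mod-lift i′≡j′+1
      ... | inj₁ p = jump⇒ci-adj (inj₂ (inj₁ refl)) (shift-flip (+ 1) p)
      ... | inj₂ p = jump⇒ci-adj (inj₂ (inj₂ (inj₁ refl)))
                       (mod-trans (shift-flip (+ 1 + + n) (mod-trans p (mod-reflexive (ℤ.+-assoc j′ (+ 1) (+ n)))))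
                                  (+-congˡ-mod i′ (subst (- (+ 1 + + n) ≡_mod N) (ℤ.neg-involutive m)
                                                         (neg-cong-mod 1+n≡-m))))

    odd-scales-n : ∀ {z} → z ≡ + 1 mod 2 → z * + n ≡ + n mod N
    odd-scales-n {z} (mod-intro (divides t z-1≡2t)) = mod-intro (divides t (begin
      z * + n - + n           ≡⟨ factor z (+ n) ⟩
      (z - + 1) * + n         ≡⟨ cong (_* + n) z-1≡2t ⟩
      t * + 2 * + n           ≡⟨ ℤ.*-assoc t (+ 2) (+ n) ⟩
      t * (+ 2 * + n)         ≡⟨ cong (t *_) (ℤ.pos-* 2 n) ⟨
      t * + N                 ∎))
      where
      open ≡-Reasoning
      factor : ∀ z n → z * n - n ≡ (z - + 1) * n
      factor = solve-∀

    -- multiplying by a⁻¹ sends ±a to ±1 and ±b = ±(n - a) to ±(n - 1)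
    Ci≅Ci-unit : ∀ {a b} → Odd a → a ℕ.+ b ≡ n → gcd N a ≡ 1 → Ci n a b ≅ Ci n 1 (ℕ.pred n)
    Ci≅Ci-unit {a} {b} odd-a a+b≡n g≡1 = Ci-scaling c (+ a) (proj₂ (inverse-mod g≡1)) forth back
      where
      open import Relation.Binary.Reasoning.Setoid (mod-setoid N)
      c : ℤ
      c = proj₁ (inverse-mod {N} {a} g≡1)

      ca≡1 : c * + a ≡ + 1 mod N
      ca≡1 = subst (_≡ + 1 mod N) (ℤ.*-comm (+ a) c) (proj₂ (inverse-mod g≡1))

      c-odd : c ≡ + 1 mod 2
      c-odd = mod-trans (mod-reflexive (sym (ℤ.*-identityʳ c)))
                (mod-trans (*-congˡ-mod c (mod-sym (odd⇒≡1-mod-2 odd-a))) (mod-weaken 2∣N ca≡1))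

      b≡n-a : + b ≡ + n - + a
      b≡n-a = trans (complement (+ a) (+ b)) (cong (_- + a) (cong +_ a+b≡n))
        where complement : ∀ a b → b ≡ (a + b) - a
              complement = solve-∀

      pred≡n-1 : + ℕ.pred n ≡ + n - + 1
      pred≡n-1 = trans (sym (minus (+ ℕ.pred n))) (cong (_- + 1) (sym pred-n))
        where minus : ∀ m → m + + 1 - + 1 ≡ m
              minus = solve-∀

      distrib : ∀ c x y → c * (x - y) ≡ c * x - c * y
      distrib = solve-∀

      *-neg : ∀ k {x y} → k * x ≡ y mod N → k * - x ≡ - y mod N
      *-neg k {x} p = mod-trans (mod-reflexive (sym (ℤ.neg-distribʳ-* k x))) (neg-cong-mod p)

      cb≡pred : c * + b ≡ + ℕ.pred n mod N
      cb≡pred = begin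
        c * + b                 ≡⟨ cong (c *_) b≡n-a ⟩
        c * (+ n - + a)         ≡⟨ distrib c (+ n) (+ a) ⟩
        c * + n - c * + a       ≈⟨ +-cong-mod (odd-scales-n c-odd) (neg-cong-mod ca≡1) ⟩
        + n - + 1               ≡⟨ pred≡n-1 ⟨
        + ℕ.pred n              ∎

      a-pred≡b : + a * + ℕ.pred n ≡ + b mod N
      a-pred≡b = begin
        + a * + ℕ.pred n        ≡⟨ cong (+ a *_) pred≡n-1 ⟩
        + a * (+ n - + 1)       ≡⟨ distrib (+ a) (+ n) (+ 1) ⟩
        + a * + n - + a * + 1   ≈⟨ +-cong-mod (odd-scales-n (odd⇒≡1-mod-2 odd-a))
                                               (mod-reflexive (cong -_ (ℤ.*-identityʳ (+ a)))) ⟩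
        + n - + a               ≡⟨ b≡n-a ⟨
        + b                     ∎

      forth : ∀ {x} → Jump a b x → Σ ℤ λ y → Jump 1 (ℕ.pred n) y × c * x ≡ y mod N
      forth (inj₁ refl)               = + 1 , inj₁ refl , ca≡1
      forth (inj₂ (inj₁ refl))        = - + 1 , inj₂ (inj₁ refl) , *-neg c ca≡1
      forth (inj₂ (inj₂ (inj₁ refl))) = + ℕ.pred n , inj₂ (inj₂ (inj₁ refl)) , cb≡pred
      forth (inj₂ (inj₂ (inj₂ refl))) = - + ℕ.pred n , inj₂ (inj₂ (inj₂ refl)) , *-neg c cb≡pred

      back : ∀ {y} → Jump 1 (ℕ.pred n) y → Σ ℤ λ x → Jump a b x × + a * y ≡ x mod N
      back (inj₁ refl)               = + a , inj₁ refl , mod-reflexive (ℤ.*-identityʳ (+ a))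
      back (inj₂ (inj₁ refl))        = - + a , inj₂ (inj₁ refl) , *-neg (+ a) (mod-reflexive (ℤ.*-identityʳ (+ a)))
      back (inj₂ (inj₂ (inj₁ refl))) = + b , inj₂ (inj₂ (inj₁ refl)) , a-pred≡b
      back (inj₂ (inj₂ (inj₂ refl))) = - + b , inj₂ (inj₂ (inj₂ refl)) , *-neg (+ a) a-pred≡b

  -- Accordion graphs

  module AccordionGraph (n : ℕ) .{{_ : NonZero n}} where

    Rung : ℕ → ℤ → ℤ → Set
    Rung k x y = y ≡ x mod n ⊎ y ≡ x + + k mod n

    AccAdjᵐ : ℕ → Fin n ⊎ Fin n → Fin n ⊎ Fin n → Set
    AccAdjᵐ k (inj₁ i) (inj₁ j) = Consecutive n (+ toℕ i) (+ toℕ j)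
    AccAdjᵐ k (inj₂ i) (inj₂ j) = Consecutive n (+ toℕ i) (+ toℕ j)
    AccAdjᵐ k (inj₁ i) (inj₂ j) = Rung k (+ toℕ i) (+ toℕ j)
    AccAdjᵐ k (inj₂ j) (inj₁ i) = Rung k (+ toℕ i) (+ toℕ j)

    AccAdj⇔ : ∀ k p q → AccAdj n k p q ⇔ AccAdjᵐ k p q
    AccAdj⇔ k (inj₁ i) (inj₁ j) = shift⇔ n i j 1 ⊎-⇔ shift⇔ n j i 1
    AccAdj⇔ k (inj₂ i) (inj₂ j) = shift⇔ n i j 1 ⊎-⇔ shift⇔ n j i 1
    AccAdj⇔ k (inj₁ i) (inj₂ j) = toℕ≡⇔mod n i j ⊎-⇔ shift⇔ n i j k
    AccAdj⇔ k (inj₂ j) (inj₁ i) = toℕ≡⇔mod n i j ⊎-⇔ shift⇔ n i j k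

    AccAdj⇒ᵐ : ∀ k p q → AccAdj n k p q → AccAdjᵐ k p q
    AccAdj⇒ᵐ k p q = Equivalence.to (AccAdj⇔ k p q)

    ᵐ⇒AccAdj : ∀ k p q → AccAdjᵐ k p q → AccAdj n k p q
    ᵐ⇒AccAdj k p q = Equivalence.from (AccAdj⇔ k p q)

    AccAdj-sym : ∀ {k p q} → AccAdj n k p q → AccAdj n k q p
    AccAdj-sym {p = inj₁ _} {inj₁ _} = Data.Sum.swap
    AccAdj-sym {p = inj₂ _} {inj₂ _} = Data.Sum.swap
    AccAdj-sym {p = inj₁ _} {inj₂ _} = λ h → h
    AccAdj-sym {p = inj₂ _} {inj₁ _} = λ h → h

    u v : ℤ → Fin n ⊎ Fin n
    u x = inj₁ (residue n x)
    v x = inj₂ (residue n x)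

    private
      pos≡ : ∀ x → + toℕ (residue n x) ≡ x mod n
      pos≡ = residue-correct n

      Rung-cong : ∀ {k x x′ y y′} → x ≡ x′ mod n → y ≡ y′ mod n → Rung k x y → Rung k x′ y′
      Rung-cong x≡x′ y≡y′ (inj₁ p) = inj₁ (mod-trans (mod-sym y≡y′) (mod-trans p x≡x′))
      Rung-cong {k} x≡x′ y≡y′ (inj₂ p) =
        inj₂ (mod-trans (mod-sym y≡y′) (mod-trans p (+-congʳ-mod (+ k) x≡x′)))

    u-u : ∀ {k} x y → Consecutive n x y → AccAdj n k (u x) (u y)
    u-u {k} x y c = ᵐ⇒AccAdj k (u x) (u y) (Consecutive-cong (mod-sym (pos≡ x)) (mod-sym (pos≡ y)) c)

    u-v : ∀ {k} x y → Rung k x y → AccAdj n k (u x) (v y)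
    u-v {k} x y r = ᵐ⇒AccAdj k (u x) (v y) (Rung-cong (mod-sym (pos≡ x)) (mod-sym (pos≡ y)) r)

    u-residue : ∀ (j : Fin n) → u (+ toℕ j) ≡ inj₁ j
    u-residue j = cong inj₁ (toℕ-injective-mod n (pos≡ (+ toℕ j)))

    Accordion-connected : ∀ {k} → Connected (Accordion n k)
    Accordion-connected {k} p q = reverse AccAdj-sym (from-u₀ p) ◅◅ from-u₀ q
      where
      along-u : ∀ i → Star (AccAdj n k) (u 0ℤ) (u (+ i))
      along-u zero    = ε
      along-u (suc i) = along-u i ◅◅ (u-u {k} (+ i) (+ suc i) (inj₁ (mod-reflexive (cong +_ (ℕ.+-comm 1 i)))) ◅ ε)

      from-u₀ : ∀ p → Star (AccAdj n k) (u 0ℤ) p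
      from-u₀ (inj₁ j) = subst (Star (AccAdj n k) (u 0ℤ)) (u-residue j) (along-u (toℕ j))
      from-u₀ (inj₂ j) = from-u₀ (inj₁ j) ◅◅ (inj₁ refl ◅ ε)

    Accordion-1-triangle : Triangle (Accordion n 1)
    Accordion-1-triangle = record
      { x = u 0ℤ ; y = u (+ 1) ; z = v (+ 1)
      ; xy = u-u {1} 0ℤ (+ 1) (inj₁ mod-refl)
      ; yz = u-v (+ 1) (+ 1) (inj₁ mod-refl)
      ; xz = u-v 0ℤ (+ 1) (inj₂ mod-refl)
      }

    u-cong : ∀ {x y} → x ≡ y mod n → u x ≡ u y
    u-cong {x} {y} p = cong inj₁ (toℕ-injective-mod n (mod-trans (pos≡ x) (mod-trans p (mod-sym (pos≡ y)))))

    Accordion-2-dominated : DominatedPair (Accordion n 2)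
    Accordion-2-dominated = record { x = u 0ℤ ; y = v (+ 1) ; distinct = λ () ; dominated = λ {z} → dominated z }
      where
      rung : ∀ {J} → Consecutive n 0ℤ J → Rung 2 J (+ 1)
      rung (inj₁ J≡1)   = inj₁ (mod-sym J≡1)
      rung {J} (inj₂ 0≡J+1) = inj₂ (mod-trans (+-congʳ-mod (+ 1) 0≡J+1) (mod-reflexive (ℤ.+-assoc J (+ 1) (+ 1))))

      consecutive : ∀ {J} → Rung 2 0ℤ J → Consecutive n (+ 1) J
      consecutive {J} (inj₁ J≡0) = inj₂ (mod-sym (+-congʳ-mod (+ 1) J≡0))
      consecutive (inj₂ J≡2)     = inj₁ J≡2

      dominated : ∀ z → AccAdj n 2 (u 0ℤ) z → AccAdj n 2 (v (+ 1)) z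
      dominated (inj₁ j) h = ᵐ⇒AccAdj 2 (v (+ 1)) (inj₁ j)
        (Rung-cong mod-refl (mod-sym (pos≡ (+ 1)))
          (rung (Consecutive-cong (pos≡ 0ℤ) mod-refl (AccAdj⇒ᵐ 2 (u 0ℤ) (inj₁ j) h))))
      dominated (inj₂ j) h = ᵐ⇒AccAdj 2 (v (+ 1)) (inj₂ j)
        (Consecutive-cong (mod-sym (pos≡ (+ 1))) mod-refl
          (consecutive (Rung-cong (pos≡ 0ℤ) mod-refl (AccAdj⇒ᵐ 2 (u 0ℤ) (inj₂ j) h))))

    offset-injective : ∀ X {c c′} → c < n → c′ < n → X + + c ≡ X + + c′ mod n → c ≡ c′
    offset-injective X c<n c′<n p = mod-unique c<n c′<n (+-cancelˡ-mod X p)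

    module _ {k : ℕ} (3≤k : 3 ≤ k) (2k≤n : 2 ℕ.* k ≤ n) where

      private
        k+k≤n : k ℕ.+ k ≤ n
        k+k≤n = subst (_≤ n) (cong (k ℕ.+_) (ℕ.+-identityʳ k)) 2k≤n
        k<n : k < n
        k<n = ℕ.<-≤-trans (ℕ.m<m+n k (ℕ.<-≤-trans (s≤s ℕ.z≤n) 3≤k)) k+k≤n
        2+k<n : 2 ℕ.+ k < n
        2+k<n = ℕ.<-≤-trans (ℕ.+-monoˡ-< k 3≤k) k+k≤n
        2<n : 2 < n
        2<n = ℕ.≤-<-trans (ℕ.m≤m+n 2 k) 2+k<n
        4<n : 4 < n
        4<n = ℕ.≤-<-trans (ℕ.+-monoʳ-≤ 2 (ℕ.<⇒≤ 3≤k)) 2+k<n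
        0<n : 0 < n
        0<n = ℕ.≤-<-trans ℕ.z≤n 2<n

        0≢2+ : ∀ m → 0 ≢ 2 ℕ.+ m
        0≢2+ _ ()

        two-ahead : ∀ i → + (2 ℕ.+ i) ≡ + i + + 2 mod n
        two-ahead i = mod-reflexive (cong +_ (ℕ.+-comm 2 i))

        middle-u : ∀ i (j : Fin n) → Consecutive n (+ i) (+ toℕ j) → Consecutive n (+ toℕ j) (+ (2 ℕ.+ i)) →
                   inj₁ j ≡ u (+ suc i)
        middle-u i j (inj₁ J≡i+1) _ =
          trans (sym (u-residue j)) (u-cong (mod-trans J≡i+1 (mod-reflexive (cong +_ (ℕ.+-comm i 1)))))
        middle-u i j (inj₂ i≡J+1) (inj₁ i+2≡J+1) = ⊥-elim (0≢2+ 0 (offset-injective (+ i) 0<n 2<n (begin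
          + i + + 0          ≡⟨ ℤ.+-identityʳ (+ i) ⟩
          + i                ≈⟨ i≡J+1 ⟩
          + toℕ j + + 1      ≈⟨ i+2≡J+1 ⟨
          + (2 ℕ.+ i)        ≈⟨ two-ahead i ⟩
          + i + + 2          ∎)))
          where open import Relation.Binary.Reasoning.Setoid (mod-setoid n)
        middle-u i j (inj₂ i≡J+1) (inj₂ J≡i+3) = ⊥-elim (0≢2+ 2 (offset-injective (+ i) 0<n 4<n (begin
          + i + + 0          ≡⟨ ℤ.+-identityʳ (+ i) ⟩
          + i                ≈⟨ i≡J+1 ⟩
          + toℕ j + + 1      ≈⟨ +-congʳ-mod (+ 1) J≡i+3 ⟩
          + (2 ℕ.+ i) + + 1 + + 1 ≡⟨ regroup (+ i) ⟩
          + i + + 4          ∎)))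
          where open import Relation.Binary.Reasoning.Setoid (mod-setoid n)
                regroup : ∀ x → + 2 + x + + 1 + + 1 ≡ x + + 4
                regroup = solve-∀

        middle-v : ∀ i {J} → Rung k (+ i) J → Rung k (+ (2 ℕ.+ i)) J → ⊥
        middle-v i (inj₁ J≡i) (inj₁ J≡i+2) = 0≢2+ 0 (offset-injective (+ i) 0<n 2<n (begin
          + i + + 0          ≡⟨ ℤ.+-identityʳ (+ i) ⟩
          + i                ≈⟨ mod-trans (mod-sym J≡i) J≡i+2 ⟩
          + (2 ℕ.+ i)        ≈⟨ two-ahead i ⟩
          + i + + 2          ∎))
          where open import Relation.Binary.Reasoning.Setoid (mod-setoid n)
        middle-v i (inj₁ J≡i) (inj₂ J≡i+2+k) = 0≢2+ k (offset-injective (+ i) 0<n 2+k<n (begin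
          + i + + 0          ≡⟨ ℤ.+-identityʳ (+ i) ⟩
          + i                ≈⟨ mod-trans (mod-sym J≡i) J≡i+2+k ⟩
          + (2 ℕ.+ i) + + k  ≡⟨ regroup (+ i) (+ k) ⟩
          + i + + (2 ℕ.+ k)  ∎))
          where open import Relation.Binary.Reasoning.Setoid (mod-setoid n)
                regroup : ∀ x y → + 2 + x + y ≡ x + (+ 2 + y)
                regroup = solve-∀
        middle-v i (inj₂ J≡i+k) (inj₁ J≡i+2) = ℕ.<⇒≢ 3≤k (sym (offset-injective (+ i) k<n 2<n (begin
          + i + + k          ≈⟨ mod-trans (mod-sym J≡i+k) J≡i+2 ⟩
          + (2 ℕ.+ i)        ≈⟨ two-ahead i ⟩
          + i + + 2          ∎)))
          where open import Relation.Binary.Reasoning.Setoid (mod-setoid n)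
        middle-v i (inj₂ J≡i+k) (inj₂ J≡i+2+k) = 0≢2+ 0 (offset-injective (+ i + + k) 0<n 2<n (begin
          + i + + k + + 0    ≡⟨ ℤ.+-identityʳ (+ i + + k) ⟩
          + i + + k          ≈⟨ mod-trans (mod-sym J≡i+k) J≡i+2+k ⟩
          + (2 ℕ.+ i) + + k  ≡⟨ regroup (+ i) (+ k) ⟩
          + i + + k + + 2    ∎))
          where open import Relation.Binary.Reasoning.Setoid (mod-setoid n)
                regroup : ∀ x y → + 2 + x + y ≡ x + y + + 2
                regroup = solve-∀

      Accordion-rigid-cycle : RigidCycle (Accordion n k) n
      Accordion-rigid-cycle = record
        { walk = walk
        ; step = λ i → u-u {k} (+ i) (+ suc i) (inj₁ (mod-reflexive (cong +_ (ℕ.+-comm 1 i))))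
        ; unique-middle = unique-middle
        ; closed = u-cong self≡0-mod
        }
        where
        walk : ℕ → Fin n ⊎ Fin n
        walk i = u (+ i)
        unique-middle : ∀ i {z} → AccAdj n k (walk i) z → AccAdj n k z (walk (2 ℕ.+ i)) → z ≡ walk (suc i)
        unique-middle i {inj₁ j} h h′ = middle-u i j
          (Consecutive-cong (pos≡ (+ i)) mod-refl (AccAdj⇒ᵐ k (walk i) (inj₁ j) h))
          (Consecutive-cong mod-refl (pos≡ (+ (2 ℕ.+ i))) (AccAdj⇒ᵐ k (inj₁ j) (walk (2 ℕ.+ i)) h′))
        unique-middle i {inj₂ j} h h′ = ⊥-elim (middle-v i
          (Rung-cong (pos≡ (+ i)) mod-refl (AccAdj⇒ᵐ k (walk i) (inj₂ j) h))
          (Rung-cong (pos≡ (+ (2 ℕ.+ i))) mod-refl (AccAdj⇒ᵐ k (inj₂ j) (walk (2 ℕ.+ i)) h′)))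

    -- uᵢ and v₍ᵢ₊₁₎ both sit at position i
    pos : Fin n ⊎ Fin n → ℤ
    pos (inj₁ i) = + toℕ i
    pos (inj₂ j) = + toℕ j - + 1

    Accordion-2⇔Consecutive : ∀ p q → AccAdj n 2 p q ⇔ Consecutive n (pos p) (pos q)
    Accordion-2⇔Consecutive p q = mk⇔ (position p q ∘ AccAdj⇒ᵐ 2 p q) (ᵐ⇒AccAdj 2 p q ∘ unposition p q)
      where
      minus-plus : ∀ x → x - + 1 + + 1 ≡ x
      minus-plus = solve-∀
      two-minus-one : ∀ x → x + + 2 - + 1 ≡ x + + 1
      two-minus-one = solve-∀

      same : ∀ {I J} → J ≡ I mod n ⇔ I ≡ J - + 1 + + 1 mod n
      same {I} {J} = mk⇔ (λ p → subst (I ≡_mod n) (sym (minus-plus J)) (mod-sym p))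
                         (λ p → mod-sym (subst (I ≡_mod n) (minus-plus J) p))

      two-apart : ∀ I {J} → J ≡ I + + 2 mod n ⇔ J - + 1 ≡ I + + 1 mod n
      two-apart I {J} = mk⇔ (λ p → subst (J - + 1 ≡_mod n) (two-minus-one I) (+-congʳ-mod (- + 1) p))
                              (λ p → +-cancelʳ-mod (- + 1) (subst (J - + 1 ≡_mod n) (sym (two-minus-one I)) p))

      shifted : ∀ {I J} → Consecutive n I J → Consecutive n (I - + 1) (J - + 1)
      shifted {I} {J} (inj₁ p) = inj₁ (subst (J - + 1 ≡_mod n) (swap₂ I (+ 1) (- + 1)) (+-congʳ-mod (- + 1) p))
        where swap₂ : ∀ x y z → x + y + z ≡ x + z + y
              swap₂ = solve-∀
      shifted {I} {J} (inj₂ p) = inj₂ (subst (I - + 1 ≡_mod n) (swap₂ J (+ 1) (- + 1)) (+-congʳ-mod (- + 1) p))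
        where swap₂ : ∀ x y z → x + y + z ≡ x + z + y
              swap₂ = solve-∀

      unshifted : ∀ {I J} → Consecutive n (I - + 1) (J - + 1) → Consecutive n I J
      unshifted {I} {J} c = subst₂ (Consecutive n) (minus-plus I) (minus-plus J) (shifted′ c)
        where
        shifted′ : ∀ {I J} → Consecutive n I J → Consecutive n (I + + 1) (J + + 1)
        shifted′ {I} {J} (inj₁ p) = inj₁ (+-congʳ-mod (+ 1) p)
        shifted′ {I} {J} (inj₂ p) = inj₂ (+-congʳ-mod (+ 1) p)

      position : ∀ p q → AccAdjᵐ 2 p q → Consecutive n (pos p) (pos q)
      position (inj₁ _) (inj₁ _) c = c
      position (inj₂ _) (inj₂ _) c = shifted c
      position (inj₁ _) (inj₂ _) (inj₁ p) = inj₂ (Equivalence.to same p)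
      position (inj₁ i) (inj₂ _) (inj₂ p) = inj₁ (Equivalence.to (two-apart (+ toℕ i)) p)
      position (inj₂ _) (inj₁ _) (inj₁ p) = inj₁ (Equivalence.to same p)
      position (inj₂ _) (inj₁ i) (inj₂ p) = inj₂ (Equivalence.to (two-apart (+ toℕ i)) p)

      unposition : ∀ p q → Consecutive n (pos p) (pos q) → AccAdjᵐ 2 p q
      unposition (inj₁ _) (inj₁ _) c = c
      unposition (inj₂ _) (inj₂ _) c = unshifted c
      unposition (inj₁ _) (inj₂ _) (inj₂ p) = inj₁ (Equivalence.from same p)
      unposition (inj₁ i) (inj₂ _) (inj₁ p) = inj₂ (Equivalence.from (two-apart (+ toℕ i)) p)
      unposition (inj₂ _) (inj₁ _) (inj₁ p) = inj₁ (Equivalence.from same p)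
      unposition (inj₂ _) (inj₁ i) (inj₂ p) = inj₂ (Equivalence.from (two-apart (+ toℕ i)) p)


  module _ (n : ℕ) .{{_ : NonZero n}} where
    open Circulant n using (N; Ci-unit⇔Consecutive)
    open AccordionGraph n using (pos; Accordion-2⇔Consecutive)

    private
      rotate : Fin (n ℕ.+ 0) → Fin n
      rotate j = residue n (+ toℕ j + + 1)

      unrotate : Fin n → Fin (n ℕ.+ 0)
      unrotate j = cast (sym (ℕ.+-identityʳ n)) (residue n (+ toℕ j - + 1))

      minus-plus : ∀ x → x - + 1 + + 1 ≡ x
      minus-plus = solve-∀

      plus-minus : ∀ x → x + + 1 - + 1 ≡ x
      plus-minus = solve-∀

      rotate-unrotate : ∀ j → rotate (unrotate j) ≡ j
      rotate-unrotate j = toℕ-injective-mod n (begin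
        + toℕ (rotate (unrotate j))                 ≈⟨ residue-correct n _ ⟩
        + toℕ (unrotate j) + + 1                    ≡⟨ cong (λ r → + r + + 1) (toℕ-cast _ (residue n (+ toℕ j - + 1))) ⟩
        + toℕ (residue n (+ toℕ j - + 1)) + + 1     ≈⟨ +-congʳ-mod (+ 1) (residue-correct n (+ toℕ j - + 1)) ⟩
        + toℕ j - + 1 + + 1                         ≡⟨ minus-plus (+ toℕ j) ⟩
        + toℕ j                                     ∎)
        where open import Relation.Binary.Reasoning.Setoid (mod-setoid n)

      unrotate-rotate : ∀ j → unrotate (rotate j) ≡ j
      unrotate-rotate j =
        toℕ-injective (trans (toℕ-cast _ _) (mod-unique (toℕ<n (residue n (+ toℕ (rotate j) - + 1))) j<n (begin
        + toℕ (residue n (+ toℕ (rotate j) - + 1))  ≈⟨ residue-correct n _ ⟩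
        + toℕ (rotate j) - + 1                      ≈⟨ +-congʳ-mod (- + 1) (residue-correct n (+ toℕ j + + 1)) ⟩
        + toℕ j + + 1 - + 1                         ≡⟨ plus-minus (+ toℕ j) ⟩
        + toℕ j                                     ∎)))
        where
        open import Relation.Binary.Reasoning.Setoid (mod-setoid n)
        j<n : toℕ j < n
        j<n = subst (toℕ j <_) (ℕ.+-identityʳ n) (toℕ<n j)

      -- vertex x < n goes to uₓ, vertex n + r goes to v₍ᵣ₊₁₎
      layers : Fin N → Fin n ⊎ Fin n
      layers x = Data.Sum.map₂ rotate (splitAt n x)

      unlayers : Fin n ⊎ Fin n → Fin N
      unlayers = join n (n ℕ.+ 0) ∘ Data.Sum.map₂ unrotate

      layers∘unlayers : ∀ p → layers (unlayers p) ≡ p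
      layers∘unlayers p rewrite splitAt-join n (n ℕ.+ 0) (Data.Sum.map₂ unrotate p) with p
      ... | inj₁ i = refl
      ... | inj₂ j = cong inj₂ (rotate-unrotate j)

      unlayers∘layers : ∀ x → unlayers (layers x) ≡ x
      unlayers∘layers x = trans (cong (join n (n ℕ.+ 0)) (unrotate∘rotate (splitAt n x))) (join-splitAt n (n ℕ.+ 0) x)
        where
        unrotate∘rotate : ∀ s → Data.Sum.map₂ unrotate (Data.Sum.map₂ rotate s) ≡ s
        unrotate∘rotate (inj₁ i) = refl
        unrotate∘rotate (inj₂ j) = cong inj₂ (unrotate-rotate j)

      pos-layers : ∀ x → pos (layers x) ≡ + toℕ x mod n
      pos-layers x = subst (λ y → pos (layers x) ≡ + toℕ y mod n) (join-splitAt n (n ℕ.+ 0) x) (pos-join (splitAt n x))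
        where
        open import Relation.Binary.Reasoning.Setoid (mod-setoid n)
        pos-join : ∀ s → pos (Data.Sum.map₂ rotate s) ≡ + toℕ (join n (n ℕ.+ 0) s) mod n
        pos-join (inj₁ i) = mod-reflexive (cong +_ (sym (toℕ-↑ˡ i (n ℕ.+ 0))))
        pos-join (inj₂ j) = begin
          + toℕ (rotate j) - + 1        ≈⟨ +-congʳ-mod (- + 1) (residue-correct n (+ toℕ j + + 1)) ⟩
          + toℕ j + + 1 - + 1           ≡⟨ plus-minus (+ toℕ j) ⟩
          + toℕ j                       ≈⟨ +-congʳ-mod (+ toℕ j) (self≡0-mod {n}) ⟨
          + n + + toℕ j                 ≡⟨ cong +_ (toℕ-↑ʳ n j) ⟨
          + toℕ (n Data.Fin.↑ʳ j)       ∎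

    Ci-unit≅Accordion-2 : Ci n 1 (ℕ.pred n) ≅ Accordion n 2
    Ci-unit≅Accordion-2 = mk≅ layers unlayers layers∘unlayers unlayers∘layers adj
      where
      adj : ∀ x y → CiAdj n 1 (ℕ.pred n) x y ⇔ AccAdj n 2 (layers x) (layers y)
      adj x y = mk⇔
        (λ h → Equivalence.from (Accordion-2⇔Consecutive (layers x) (layers y))
                 (Consecutive-cong (mod-sym (pos-layers x)) (mod-sym (pos-layers y))
                   (Equivalence.to (Ci-unit⇔Consecutive x y) h)))
        (λ h → Equivalence.from (Ci-unit⇔Consecutive x y)
                 (Consecutive-cong (pos-layers x) (pos-layers y)
                   (Equivalence.to (Accordion-2⇔Consecutive (layers x) (layers y)) h)))

  module _ {n : ℕ} .{{_ : NonZero n}} where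
    open Circulant n
    open AccordionGraph n

    Ci≅Accordion⇒k≡2 : ∀ {k a b} → 1 ≤ k → 2 ℕ.* k ≤ n → Odd a → Odd b → Ci n a b ≅ Accordion n k → k ≡ 2
    Ci≅Accordion⇒k≡2 {1} _ _ odd-a odd-b φ =
      ⊥-elim (Ci-triangle-free odd-a odd-b (≅-preserves-Triangle (≅-sym φ) Accordion-1-triangle))
    Ci≅Accordion⇒k≡2 {2} _ _ _ _ _ = refl
    Ci≅Accordion⇒k≡2 {k@(suc (suc (suc _)))} {a} {b} _ 2k≤n odd-a odd-b φ =
      ⊥-elim (no-odd-multiple (RigidCycle⇒jump-multiple cycle))
      where
      cycle : RigidCycle (Ci n a b) n
      cycle = ≅-preserves-RigidCycle (≅-sym φ) (Accordion-rigid-cycle {k} (s≤s (s≤s (s≤s ℕ.z≤n))) 2k≤n)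
      no-odd-multiple : ¬ (Σ ℤ λ x → Jump a b x × + n * x ≡ 0ℤ mod N)
      no-odd-multiple (x , jx , nx≡0) = odd-multiple (jump-odd odd-a odd-b jx) nx≡0

    Ci≅Accordion⇒conditions : ∀ {k a b} → 1 ≤ k → 2 ℕ.* k ≤ n → 1 ≤ a → 1 ≤ b → a < n → b < n → a ≢ b →
      Odd a → Odd b → Ci n a b ≅ Accordion n k →
      (Even n × k ≡ 2) × (gcd (2 ℕ.* n) a ≡ 1 × gcd (2 ℕ.* n) b ≡ 1) × a ℕ.+ b ≡ n
    Ci≅Accordion⇒conditions {k} {a} {b} 1≤k 2k≤n 1≤a 1≤b a<n b<n a≢b odd-a odd-b φ =
      (subst Even a+b≡n (odd+odd-even odd-a odd-b) , k≡2) , (gcd-a , gcd-b) , a+b≡n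
      where
      k≡2 : k ≡ 2
      k≡2 = Ci≅Accordion⇒k≡2 1≤k 2k≤n odd-a odd-b φ
      φ₂ : Ci n a b ≅ Accordion n 2
      φ₂ = subst (λ k → Ci n a b ≅ Accordion n k) k≡2 φ
      a+b≡n : a ℕ.+ b ≡ n
      a+b≡n = Ci-dominated⇒a+b≡n 1≤a a<n 1≤b b<n a≢b (≅-preserves-DominatedPair (≅-sym φ₂) Accordion-2-dominated)
      b+a≡n : b ℕ.+ a ≡ n
      b+a≡n = trans (ℕ.+-comm b a) a+b≡n
      connected : Connected (Ci n a b)
      connected = ≅-preserves-Connected (≅-sym φ) Accordion-connected
      gcd-a : gcd N a ≡ 1
      gcd-a = Ci-connected⇒gcd≡1 connected (gcd[m,n]∣m N a) (gcd[m,n]∣n N a) (gcd-divides-complement odd-a a+b≡n)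
      gcd-b : gcd N b ≡ 1
      gcd-b = Ci-connected⇒gcd≡1 connected (gcd[m,n]∣m N b) (gcd-divides-complement odd-b b+a≡n) (gcd[m,n]∣n N b)

    conditions⇒Ci≅Accordion : ∀ {k a b} → Odd a →
      (Even n × k ≡ 2) × (gcd (2 ℕ.* n) a ≡ 1 × gcd (2 ℕ.* n) b ≡ 1) × a ℕ.+ b ≡ n → Ci n a b ≅ Accordion n k
    conditions⇒Ci≅Accordion {a = a} {b} odd-a ((_ , k≡2) , (gcd-a , _) , a+b≡n) =
      subst (λ k → Ci n a b ≅ Accordion n k) (sym k≡2) (≅-trans (Ci≅Ci-unit odd-a a+b≡n gcd-a) (Ci-unit≅Accordion-2 n))

open Lemmas
open import Defs
open import Data.Nat using (ℕ; suc; s≤s; _+_; _*_; _≤_; _<_)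
open import Data.Nat.GCD using (gcd)
open import Data.Product using (_×_)
open import Relation.Binary.PropositionalEquality using (_≡_; _≢_)
open import Function.Bundles using (_⇔_; mk⇔)

theorem2p5 : (n k a b : ℕ) → 3 ≤ n → 1 ≤ k → 2 * k ≤ n →
    1 ≤ a → 1 ≤ b → a < n → b < n → a ≢ b → Odd a → Odd b →
    (Ci n a b ≅ Accordion n k) ⇔
      ((Even n × k ≡ 2) × (gcd (2 * n) a ≡ 1 × gcd (2 * n) b ≡ 1) × a + b ≡ n)
-- matching on 3 ≤ n makes n a successor, which supplies the NonZero n instance
theorem2p5 (suc m) k a b (s≤s _) 1≤k 2k≤n 1≤a 1≤b a<n b<n a≢b odd-a odd-b =
  mk⇔ (Ci≅Accordion⇒conditions 1≤k 2k≤n 1≤a 1≤b a<n b<n a≢b odd-a odd-b)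
      (conditions⇒Ci≅Accordion odd-a)
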